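{- Let $n\ge 1$ and $0\le j\le n$. The number $a(n,j)$ of signed permutations of $[n]$ with exactly $j$ odd cycles is \[ a(n,j)=\sum_{i=j}^{n} c(n,i)\binom{i}{j}2^{\,n-i}, \] where $c(n,i)$ is the unsigned Stirling number of the first kind, i.e. the number of permutations of $[n]$ with exactly $i$ cycles.
   Context: A signed permutation of $[n]$ is a pair $(\pi,w)$ where $\pi=\pi_1\cdots\pi_n$ is a permutation of $[n]$ and $w=w_1\cdots w_n\in\{+,-\}^n$, the sign $w_i$ being assigned to $\pi_i$. Its compartments are defined as follows: draw a line before $\pi_1$; then repeatedly, among the entries after the last line drawn, locate the least one and draw a line immediately after it; stop when a line has been drawn after $\pi_n$. The maximal segments between consecutive lines are the compartments. An odd cycle of the signed permutation is a compartment containing an odd number of entries with sign $-$; the number of odd cycles is the number of such compartments. -}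

module Defs where

open import Data.Nat using (ℕ; zero; suc; _+_; _*_; _∸_; _^_; _≤ᵇ_; _≡ᵇ_; _<ᵇ_)
open import Data.Bool using (Bool; true; false; not; _∧_; _∨_; if_then_else_)
open import Data.List using (List; []; _∷_; map; concatMap; length; filterᵇ; upTo; zip)
open import Data.Bool.ListAction using (all; any)
open import Data.Nat.ListAction using (sum)
open import Data.Product using (_×_; _,_; proj₁; proj₂)

range1 : ℕ → List ℕ
range1 n = map suc (upTo n)

words : ℕ → ℕ → List (List ℕ)
words n zero    = [] ∷ []
words n (suc k) = concatMap (λ x → map (x ∷_) (words n k)) (range1 n)

distinctᵇ : List ℕ → Bool
distinctᵇ []       = true
distinctᵇ (x ∷ xs) = not (any (λ y → x ≡ᵇ y) xs) ∧ distinctᵇ xs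

perms : ℕ → List (List ℕ)
perms n = filterᵇ distinctᵇ (words n n)

-- all sign words w ∈ {+,-}ⁿ ; true encodes the sign '-', false encodes '+'
signWords : ℕ → List (List Bool)
signWords zero    = [] ∷ []
signWords (suc k) = concatMap (λ b → map (b ∷_) (signWords k)) (true ∷ false ∷ [])

signedPerms : ℕ → List (List ℕ × List Bool)
signedPerms n = concatMap (λ π → map (π ,_) (signWords n)) (perms n)

-- minimum value of a nonempty list of entries (default for [] irrelevant)
minVal : List (ℕ × Bool) → ℕ
minVal []             = 0
minVal ((v , _) ∷ []) = v
minVal ((v , _) ∷ xs@(_ ∷ _)) with minVal xs
... | m = if v ≤ᵇ m then v else m

splitAfter : ℕ → List (ℕ × Bool) → List (ℕ × Bool) × List (ℕ × Bool)
splitAfter m []              = [] , []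
splitAfter m ((v , s) ∷ xs) with v ≡ᵇ m
... | true  = ((v , s) ∷ []) , xs
... | false with splitAfter m xs
...   | (p , r) = ((v , s) ∷ p) , r

-- compartments: repeatedly cut right after the least remaining entry
-- (fuel argument; fuel = length of the list suffices since each step removes ≥ 1 entry)
compartmentsFuel : ℕ → List (ℕ × Bool) → List (List (ℕ × Bool))
compartmentsFuel zero     _  = []
compartmentsFuel (suc f) [] = []
compartmentsFuel (suc f) xs@(_ ∷ _) with splitAfter (minVal xs) xs
... | (p , r) = p ∷ compartmentsFuel f r

compartments : List ℕ × List Bool → List (List (ℕ × Bool))
compartments (π , w) = compartmentsFuel (length π) (zip π w)

minusCount : List (ℕ × Bool) → ℕ
minusCount [] = 0
minusCount ((_ , true) ∷ xs)  = suc (minusCount xs)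
minusCount ((_ , false) ∷ xs) = minusCount xs

oddᵇ : ℕ → Bool
oddᵇ zero    = false
oddᵇ (suc k) = not (oddᵇ k)

-- number of odd cycles = number of compartments with an odd number of '-' signs
oddCycles : List ℕ × List Bool → ℕ
oddCycles σ = length (filterᵇ (λ C → oddᵇ (minusCount C)) (compartments σ))

a : ℕ → ℕ → ℕ
a n j = length (filterᵇ (λ σ → oddCycles σ ≡ᵇ j) (signedPerms n))

-- π(i) = πᵢ  (1-indexed lookup)
app : List ℕ → ℕ → ℕ
app []       _             = 0
app (x ∷ xs) zero          = 0
app (x ∷ xs) (suc zero)    = x
app (x ∷ xs) (suc (suc i)) = app xs (suc i)

iter : List ℕ → ℕ → ℕ → ℕ
iter π zero    i = i
iter π (suc k) i = app π (iter π k i)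

-- i is the least element of its cycle: πᵏ(i) ≥ i for all 0 ≤ k < n
-- (every cycle of a permutation of [n] has length ≤ n)
isCycleMin : ℕ → List ℕ → ℕ → Bool
isCycleMin n π i = all (λ k → i ≤ᵇ iter π k i) (upTo n)

-- number of cycles of π = number of cycles' least elements
cycleCount : ℕ → List ℕ → ℕ
cycleCount n π = length (filterᵇ (isCycleMin n π) (range1 n))

c : ℕ → ℕ → ℕ
c n i = length (filterᵇ (λ π → cycleCount n π ≡ᵇ i) (perms n))

sumFromTo : ℕ → ℕ → (ℕ → ℕ) → ℕ
sumFromTo j n f = sum (map (λ t → f (j + t)) (upTo (suc n ∸ j)))

-- Fix π. Where the compartment lines go depends on π only, and a compartment of s entries
-- is odd for exactly half of its 2^s sign choices; so if π has k compartments, exactly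
-- C(k,j) 2^(n-k) sign words give j odd cycles, and a(n,j) = Σ_π C(k(π),j) 2^(n-k(π)).
-- It remains to see that the number of compartments is distributed over Sₙ like the number
-- of cycles. Both statistics obey the recurrence of c(n,i): inserting n+1 into a
-- permutation of [n] in one of n+1 ways (as a new entry of the word, resp. into a cycle
-- right after one of 1,…,n or as a fixed point) is a bijection onto Sₙ₊₁, and raises
-- the statistic by one for exactly one of the n+1 ways.

module Submission where

open import Defs
open import Data.Bool using (Bool; true; false; not; if_then_else_; T; T?)
open import Data.Bool.ListAction using (any)
open import Data.Bool.Properties using (T-∧; T-not-≡; T-≡)
open import Data.List
  using (List; []; _∷_; _++_; _∷ʳ_; initLast; _∷ʳ′_; map; concatMap; length; filter; filterᵇ; upTo; take; drop; zip;
         cartesianProduct; cartesianProductWith)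
open import Data.List.Membership.Propositional as Membership using (_∈_)
open import Data.List.Membership.Propositional.Properties
  using (∈-map⁺; ∈-map⁻; ∈-cartesianProduct⁺; ∈-cartesianProduct⁻; ∈-cartesianProductWith⁺; ∈-cartesianProductWith⁻;
         ∈-upTo⁺; ∈-upTo⁻; ∈-filter⁺; ∈-filter⁻; ∈-∃++; ∈-++⁻)
open import Data.List.Membership.Propositional.Properties.WithK using (unique∧set⇒bag)
open import Data.List.Properties
  using (map-++; map-∘; map-cong; map-cong-local; length-++; length-map; length-upTo; upTo-∷ʳ; length-drop; take-map;
         drop-map; length-filter; length-++-≤ˡ; ∷-injective; ∷-injectiveˡ; ∷ʳ-injective)
open import Data.List.Relation.Binary.BagAndSetEquality using (∼bag⇒↭)
open import Data.List.Relation.Binary.Permutation.Propositional using (_↭_; ↭-refl; ↭-sym; ↭-trans; prep; swap; ↭⇒↭ₛ)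
open import Data.List.Relation.Binary.Permutation.Propositional.Properties as PermProp using (map⁺; ↭-length)
import Data.List.Relation.Binary.Permutation.Setoid.Properties as PermSetoid
open import Data.List.Relation.Unary.All as All using (All; []; _∷_)
import Data.List.Relation.Unary.All.Properties as AllP
open import Data.List.Relation.Unary.AllPairs using ([]; _∷_)
open import Data.List.Relation.Unary.Any as AnyM using (here; there; any?)
open import Data.List.Relation.Unary.Any.Properties using (any⁺; any⁻)
open import Data.List.Relation.Unary.Unique.Propositional using (Unique)
import Data.List.Relation.Unary.Unique.Propositional.Properties as Unique
open import Data.Nat using (ℕ; zero; suc; _+_; _*_; _∸_; _^_; _≤_; _<_; z≤n; s≤s; s≤s⁻¹; _≡ᵇ_; _≤ᵇ_; _≟_; _≤?_; _<?_)
open import Data.Nat.Combinatorics using (_C_; nCk+nC[k+1]≡[n+1]C[k+1]; k>n⇒nCk≡0)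
open import Data.Nat.ListAction using (sum)
open import Data.Nat.ListAction.Properties using (sum-++; sum-↭)
open import Data.Nat.Properties
open import Data.Nat.Tactic.RingSolver using (solve-∀)
open import Data.List.Membership.DecPropositional _≟_ using (_∈?_)
open import Data.Product using (∃; _×_; _,_; proj₁; proj₂; map₁; map₂; uncurry)
open import Data.Sum using (_⊎_; inj₁; inj₂)
open import Function using (_∘_)
open import Function.Bundles using (_⇔_; mk⇔; Equivalence)
open import Relation.Binary.Definitions using (tri<; tri≈; tri>)
open import Relation.Binary.PropositionalEquality
open import Relation.Nullary using (¬_; yes; no; contradiction)
open import Relation.Nullary.Decidable using (dec-true; dec-false; does-⇔)

private variable A B : Set

∑ : List A → (A → ℕ) → ℕ
∑ xs f = sum (map f xs)

𝟙 : Bool → ℕ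
𝟙 b = if b then 1 else 0

∑-++ : (xs ys : List A) (f : A → ℕ) → ∑ (xs ++ ys) f ≡ ∑ xs f + ∑ ys f
∑-++ xs ys f = trans (cong sum (map-++ f xs ys)) (sum-++ (map f xs) (map f ys))

∑-map : (g : A → B) (xs : List A) (f : B → ℕ) → ∑ (map g xs) f ≡ ∑ xs (f ∘ g)
∑-map g xs f = cong sum (sym (map-∘ xs))

∑-concatMap : (g : A → List B) (xs : List A) (f : B → ℕ) →
  ∑ (concatMap g xs) f ≡ ∑ xs (λ x → ∑ (g x) f)
∑-concatMap g []       f = refl
∑-concatMap g (x ∷ xs) f =
  trans (∑-++ (g x) (concatMap g xs) f) (cong (∑ (g x) f +_) (∑-concatMap g xs f))

∑-cong : (xs : List A) {f g : A → ℕ} → (∀ x → f x ≡ g x) → ∑ xs f ≡ ∑ xs g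
∑-cong xs f≗g = cong sum (map-cong f≗g xs)

∑-∈-cong : (xs : List A) {f g : A → ℕ} → (∀ {x} → x ∈ xs → f x ≡ g x) → ∑ xs f ≡ ∑ xs g
∑-∈-cong xs eq = cong sum (map-cong-local (All.tabulate eq))

∑-+ : (xs : List A) (f g : A → ℕ) → ∑ xs (λ x → f x + g x) ≡ ∑ xs f + ∑ xs g
∑-+ []       f g = refl
∑-+ (x ∷ xs) f g = trans (cong (f x + g x +_) (∑-+ xs f g)) (+-+-swap (f x) (g x) _ _)
  where
  +-+-swap : ∀ a b c d → (a + b) + (c + d) ≡ (a + c) + (b + d)
  +-+-swap = solve-∀

∑-*ˡ : (xs : List A) (k : ℕ) (f : A → ℕ) → ∑ xs (λ x → k * f x) ≡ k * ∑ xs f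
∑-*ˡ []       k f = sym (*-zeroʳ k)
∑-*ˡ (x ∷ xs) k f = trans (cong (k * f x +_) (∑-*ˡ xs k f)) (sym (*-distribˡ-+ k (f x) _))

∑-*ʳ : (xs : List A) (f : A → ℕ) (k : ℕ) → ∑ xs (λ x → f x * k) ≡ ∑ xs f * k
∑-*ʳ xs f k = trans (∑-cong xs (λ x → *-comm (f x) k)) (trans (∑-*ˡ xs k f) (*-comm k _))

∑-const : (xs : List A) (k : ℕ) → ∑ xs (λ _ → k) ≡ length xs * k
∑-const []       k = refl
∑-const (x ∷ xs) k = cong (k +_) (∑-const xs k)

∑-zero : (xs : List A) {f : A → ℕ} → (∀ {x} → x ∈ xs → f x ≡ 0) → ∑ xs f ≡ 0
∑-zero xs f≡0 = trans (∑-∈-cong xs f≡0) (trans (∑-const xs 0) (*-zeroʳ (length xs)))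

∑-comm : (xs : List A) (ys : List B) (f : A → B → ℕ) →
  ∑ xs (λ x → ∑ ys (f x)) ≡ ∑ ys (λ y → ∑ xs (λ x → f x y))
∑-comm []       ys f = sym (∑-zero ys (λ _ → refl))
∑-comm (x ∷ xs) ys f = trans (cong (∑ ys (f x) +_) (∑-comm xs ys f)) (sym (∑-+ ys (f x) _))

length-filterᵇ : (p : A → Bool) (xs : List A) → length (filterᵇ p xs) ≡ ∑ xs (𝟙 ∘ p)
length-filterᵇ p []       = refl
length-filterᵇ p (x ∷ xs) with p x
... | true  = cong suc (length-filterᵇ p xs)
... | false = length-filterᵇ p xs

∑-↭ : {xs ys : List A} (f : A → ℕ) → xs ↭ ys → ∑ xs f ≡ ∑ ys f
∑-↭ f xs↭ys = sum-↭ (map⁺ f xs↭ys)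

∑-cartesianProduct : (xs : List A) (ys : List B) (f : A × B → ℕ) →
  ∑ (cartesianProduct xs ys) f ≡ ∑ xs (λ x → ∑ ys (λ y → f (x , y)))
∑-cartesianProduct []       ys f = refl
∑-cartesianProduct (x ∷ xs) ys f = trans (∑-++ (map (x ,_) ys) _ f)
  (cong₂ _+_ (∑-map (x ,_) ys f) (∑-cartesianProduct xs ys f))

map-unique : (g : A → B) {xs : List A} → Unique xs →
  (∀ {x y} → x ∈ xs → y ∈ xs → g x ≡ g y → x ≡ y) → Unique (map g xs)
map-unique g {[]}     []         inj = []
map-unique g {x ∷ xs} (x∉ ∷ uxs) inj =
  AllP.map⁺ (All.tabulate (λ y∈ gx≡gy → All.lookup x∉ y∈ (inj (here refl) (there y∈) gx≡gy)))
  ∷ map-unique g uxs (λ x∈ y∈ → inj (there x∈) (there y∈))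

∑-reindex : {xs : List A} {ys : List B} (g : A → B) → Unique xs → Unique ys →
  (∀ {x y} → x ∈ xs → y ∈ xs → g x ≡ g y → x ≡ y) →
  (∀ {x} → x ∈ xs → g x ∈ ys) → (∀ {y} → y ∈ ys → ∃ λ x → x ∈ xs × g x ≡ y) →
  (f : B → ℕ) → ∑ ys f ≡ ∑ xs (f ∘ g)
∑-reindex {xs = xs} {ys} g uxs uys inj into onto f =
  trans (∑-↭ f (∼bag⇒↭ (unique∧set⇒bag uys (map-unique g uxs inj) (mk⇔ to from)))) (∑-map g xs f)
  where
  to : ∀ {y} → y ∈ ys → y ∈ map g xs
  to y∈ with x , x∈ , refl ← onto y∈ = ∈-map⁺ g x∈
  from : ∀ {y} → y ∈ map g xs → y ∈ ys
  from y∈ with x , x∈ , refl ← ∈-map⁻ g y∈ = into x∈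

minuses : List Bool → ℕ
minuses []          = 0
minuses (true ∷ w)  = suc (minuses w)
minuses (false ∷ w) = minuses w

blocks : List ℕ → List A → List (List A)
blocks []      xs = []
blocks (s ∷ S) xs = take s xs ∷ blocks S (drop s xs)

oddBlocks : List ℕ → List Bool → ℕ
oddBlocks S w = ∑ (blocks S w) (𝟙 ∘ oddᵇ ∘ minuses)

∑-signWords-suc : ∀ n (F : List Bool → ℕ) →
  ∑ (signWords (suc n)) F ≡ ∑ (signWords n) (F ∘ (true ∷_)) + ∑ (signWords n) (F ∘ (false ∷_))
∑-signWords-suc n F = trans (∑-concatMap (λ b → map (b ∷_) (signWords n)) (true ∷ false ∷ []) F)
  (cong₂ _+_ (∑-map (true ∷_) (signWords n) F) (trans (+-identityʳ _) (∑-map (false ∷_) (signWords n) F)))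

∑-signWords-++ : ∀ a b (F : List Bool → ℕ) →
  ∑ (signWords (a + b)) F ≡ ∑ (signWords a) (λ u → ∑ (signWords b) (λ v → F (u ++ v)))
∑-signWords-++ zero    b F = sym (+-identityʳ _)
∑-signWords-++ (suc a) b F = begin
  ∑ (signWords (suc a + b)) F
    ≡⟨ ∑-signWords-suc (a + b) F ⟩
  ∑ (signWords (a + b)) (F ∘ (true ∷_)) + ∑ (signWords (a + b)) (F ∘ (false ∷_))
    ≡⟨ cong₂ _+_ (∑-signWords-++ a b (F ∘ (true ∷_))) (∑-signWords-++ a b (F ∘ (false ∷_))) ⟩
  _ ≡⟨ ∑-signWords-suc a (λ u → ∑ (signWords b) (λ v → F (u ++ v))) ⟨
  ∑ (signWords (suc a)) (λ u → ∑ (signWords b) (λ v → F (u ++ v))) ∎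
  where open ≡-Reasoning

∑-signWords-cong : ∀ n {F G : List Bool → ℕ} → (∀ {w} → length w ≡ n → F w ≡ G w) →
  ∑ (signWords n) F ≡ ∑ (signWords n) G
∑-signWords-cong zero    F≡G = cong (_+ 0) (F≡G refl)
∑-signWords-cong (suc n) F≡G = trans (∑-signWords-suc n _) (trans
  (cong₂ _+_ (∑-signWords-cong n (F≡G ∘ cong suc)) (∑-signWords-cong n (F≡G ∘ cong suc)))
  (sym (∑-signWords-suc n _)))

length-signWords : ∀ n → length (signWords n) ≡ 2 ^ n
length-signWords zero    = refl
length-signWords (suc n) = begin
  length (signWords (suc n))                            ≡⟨ length≡∑1 (signWords (suc n)) ⟩
  ∑ (signWords (suc n)) (λ _ → 1)                       ≡⟨ ∑-signWords-suc n (λ _ → 1) ⟩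
  ∑ (signWords n) (λ _ → 1) + ∑ (signWords n) (λ _ → 1) ≡⟨ cong (λ k → k + k) 2ⁿ≡ ⟩
  2 ^ n + 2 ^ n                                         ≡⟨ cong (2 ^ n +_) (+-identityʳ (2 ^ n)) ⟨
  2 ^ n + (2 ^ n + 0)                                   ∎
  where
  open ≡-Reasoning
  length≡∑1 : (xs : List A) → length xs ≡ ∑ xs (λ _ → 1)
  length≡∑1 xs = trans (sym (*-identityʳ (length xs))) (sym (∑-const xs 1))
  2ⁿ≡ : ∑ (signWords n) (λ _ → 1) ≡ 2 ^ n
  2ⁿ≡ = trans (sym (length≡∑1 (signWords n))) (length-signWords n)

∑-signWords-parity : ∀ s (G : Bool → ℕ) →
  ∑ (signWords (suc s)) (G ∘ oddᵇ ∘ minuses) ≡ 2 ^ s * (G true + G false)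
∑-signWords-parity s G = begin
  ∑ (signWords (suc s)) (G ∘ oddᵇ ∘ minuses)
    ≡⟨ ∑-signWords-suc s _ ⟩
  ∑ (signWords s) (G ∘ not ∘ oddᵇ ∘ minuses) + ∑ (signWords s) (G ∘ oddᵇ ∘ minuses)
    ≡⟨ ∑-+ (signWords s) _ _ ⟨
  ∑ (signWords s) (λ u → G (not (oddᵇ (minuses u))) + G (oddᵇ (minuses u)))
    ≡⟨ ∑-cong (signWords s) (λ u → flip-sum (oddᵇ (minuses u))) ⟩
  ∑ (signWords s) (λ _ → G true + G false)
    ≡⟨ trans (∑-const (signWords s) _) (cong (_* (G true + G false)) (length-signWords s)) ⟩
  2 ^ s * (G true + G false) ∎
  where
  open ≡-Reasoning
  flip-sum : ∀ b → G (not b) + G b ≡ G true + G false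
  flip-sum true  = +-comm (G false) (G true)
  flip-sum false = refl

take-length-++ : (u v : List A) → take (length u) (u ++ v) ≡ u
take-length-++ []      v = refl
take-length-++ (x ∷ u) v = cong (x ∷_) (take-length-++ u v)

drop-length-++ : (u v : List A) → drop (length u) (u ++ v) ≡ v
drop-length-++ []      v = refl
drop-length-++ (x ∷ u) v = drop-length-++ u v

oddBlocks-++ : ∀ S (u v : List Bool) →
  oddBlocks (length u ∷ S) (u ++ v) ≡ 𝟙 (oddᵇ (minuses u)) + oddBlocks S v
oddBlocks-++ S u v rewrite take-length-++ u v | drop-length-++ u v = refl

length≤sum : ∀ {S} → All (1 ≤_) S → length S ≤ sum S
length≤sum []         = z≤n
length≤sum (s≥1 ∷ S⁺) = +-mono-≤ s≥1 (length≤sum S⁺)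

oddBlockCount : List ℕ → ℕ → ℕ
oddBlockCount S j = ∑ (signWords (sum S)) (λ w → 𝟙 (oddBlocks S w ≡ᵇ j))

-- The first block is odd for half of its sign choices, independently of the other blocks,
-- which gives Pascal's recurrence in j.
oddBlockCount-binomial : ∀ {S} → All (1 ≤_) S → ∀ j →
  oddBlockCount S j ≡ (length S C j) * 2 ^ (sum S ∸ length S)
oddBlockCount-binomial {[]} [] zero    = refl
oddBlockCount-binomial {[]} [] (suc j) = refl
oddBlockCount-binomial {suc s ∷ S} (_ ∷ S⁺) j = begin
  oddBlockCount (suc s ∷ S) j
    ≡⟨ ∑-signWords-++ (suc s) (sum S) _ ⟩
  ∑ (signWords (suc s)) (λ u → ∑ (signWords (sum S)) (λ v → 𝟙 (oddBlocks (suc s ∷ S) (u ++ v) ≡ᵇ j)))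
    ≡⟨ ∑-signWords-cong (suc s) (λ {u} |u| → ∑-cong (signWords (sum S)) (λ v →
         trans (cong (λ k → 𝟙 (oddBlocks (k ∷ S) (u ++ v) ≡ᵇ j)) (sym |u|))
               (cong (λ k → 𝟙 (k ≡ᵇ j)) (oddBlocks-++ S u v)))) ⟩
  ∑ (signWords (suc s)) (G j ∘ oddᵇ ∘ minuses)
    ≡⟨ ∑-signWords-parity s (G j) ⟩
  2 ^ s * (G j true + G j false)
    ≡⟨ pascal j ⟩
  (suc (length S) C j) * (2 ^ s * 2 ^ e)
    ≡⟨ cong ((suc (length S) C j) *_) (trans (sym (^-distribˡ-+-* 2 s e)) (cong (2 ^_) (sym (+-∸-assoc s |S|≤)))) ⟩
  (suc (length S) C j) * 2 ^ (s + sum S ∸ length S) ∎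
  where
  open ≡-Reasoning
  |S|≤ = length≤sum S⁺
  e = sum S ∸ length S
  G : ℕ → Bool → ℕ
  G j b = ∑ (signWords (sum S)) (λ v → 𝟙 ((𝟙 b + oddBlocks S v) ≡ᵇ j))
  pascal : ∀ j → 2 ^ s * (G j true + G j false) ≡ (suc (length S) C j) * (2 ^ s * 2 ^ e)
  pascal zero = begin
    2 ^ s * (G 0 true + oddBlockCount S 0)
      ≡⟨ cong (λ k → 2 ^ s * (k + oddBlockCount S 0)) (∑-zero (signWords (sum S)) (λ _ → refl)) ⟩
    2 ^ s * oddBlockCount S 0
      ≡⟨ cong (2 ^ s *_) (trans (oddBlockCount-binomial S⁺ 0) (*-identityˡ (2 ^ e))) ⟩
    2 ^ s * 2 ^ e
      ≡⟨ *-identityˡ _ ⟨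
    1 * (2 ^ s * 2 ^ e) ∎
  pascal (suc j) = begin
    2 ^ s * (oddBlockCount S j + oddBlockCount S (suc j))
      ≡⟨ cong₂ (λ x y → 2 ^ s * (x + y)) (oddBlockCount-binomial S⁺ j) (oddBlockCount-binomial S⁺ (suc j)) ⟩
    2 ^ s * ((length S C j) * 2 ^ e + (length S C suc j) * 2 ^ e)
      ≡⟨ regroup (2 ^ s) (length S C j) (length S C suc j) (2 ^ e) ⟩
    ((length S C j) + (length S C suc j)) * (2 ^ s * 2 ^ e)
      ≡⟨ cong (_* (2 ^ s * 2 ^ e)) (nCk+nC[k+1]≡[n+1]C[k+1] (length S) j) ⟩
    (suc (length S) C suc j) * (2 ^ s * 2 ^ e) ∎
    where
    regroup : ∀ p a b q → p * (a * q + b * q) ≡ (a + b) * (p * q)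
    regroup = solve-∀

-- Compartments, read off the values alone

least : List ℕ → ℕ
least []                = 0
least (v ∷ [])          = v
least (v ∷ vs@(_ ∷ _)) = if v ≤ᵇ least vs then v else least vs

throughFirst : ℕ → List ℕ → ℕ
throughFirst m []       = 0
throughFirst m (v ∷ vs) = if v ≡ᵇ m then 1 else suc (throughFirst m vs)

compartmentSizes : ℕ → List ℕ → List ℕ
compartmentSizes zero    _                = []
compartmentSizes (suc f) []               = []
compartmentSizes (suc f) vs@(_ ∷ _) =
  throughFirst (least vs) vs ∷ compartmentSizes f (drop (throughFirst (least vs) vs) vs)

compartmentCount : ℕ → List ℕ → ℕ
compartmentCount n π = length (compartmentSizes n π)

minVal≡least : (xs : List (ℕ × Bool)) → minVal xs ≡ least (map proj₁ xs)
minVal≡least []                = refl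
minVal≡least (_ ∷ [])          = refl
minVal≡least (_ ∷ xs@(_ ∷ _)) rewrite minVal≡least xs = refl

splitAfter≡take,drop : ∀ m (xs : List (ℕ × Bool)) →
  let k = throughFirst m (map proj₁ xs) in splitAfter m xs ≡ (take k xs , drop k xs)
splitAfter≡take,drop m []             = refl
splitAfter≡take,drop m ((v , s) ∷ xs) with v ≡ᵇ m
... | true  = refl
... | false rewrite splitAfter≡take,drop m xs = refl

compartmentsFuel≡blocks : ∀ f (xs : List (ℕ × Bool)) →
  compartmentsFuel f xs ≡ blocks (compartmentSizes f (map proj₁ xs)) xs
compartmentsFuel≡blocks zero    xs       = refl
compartmentsFuel≡blocks (suc f) []       = refl
compartmentsFuel≡blocks (suc f) xs@(_ ∷ _)
  rewrite minVal≡least xs | splitAfter≡take,drop (least (map proj₁ xs)) xs =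
  cong (_ ∷_) (trans (compartmentsFuel≡blocks f (drop k xs))
                     (cong (λ vs → blocks (compartmentSizes f vs) (drop k xs)) (sym (drop-map k xs))))
  where k = throughFirst (least (map proj₁ xs)) (map proj₁ xs)

minusCount≡minuses : (C : List (ℕ × Bool)) → minusCount C ≡ minuses (map proj₂ C)
minusCount≡minuses []                = refl
minusCount≡minuses ((_ , true)  ∷ C) = cong suc (minusCount≡minuses C)
minusCount≡minuses ((_ , false) ∷ C) = minusCount≡minuses C

map-blocks : (g : A → B) (S : List ℕ) (xs : List A) → map (map g) (blocks S xs) ≡ blocks S (map g xs)
map-blocks g []      xs = refl
map-blocks g (s ∷ S) xs =
  cong₂ _∷_ (sym (take-map s xs)) (trans (map-blocks g S (drop s xs)) (cong (blocks S) (sym (drop-map s xs))))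

map-proj₁-zip : (π : List ℕ) (w : List Bool) → length π ≡ length w → map proj₁ (zip π w) ≡ π
map-proj₁-zip []      []      _     = refl
map-proj₁-zip (x ∷ π) (_ ∷ w) |π|≡|w| = cong (x ∷_) (map-proj₁-zip π w (suc-injective |π|≡|w|))

map-proj₂-zip : (π : List ℕ) (w : List Bool) → length π ≡ length w → map proj₂ (zip π w) ≡ w
map-proj₂-zip []      []      _     = refl
map-proj₂-zip (_ ∷ π) (b ∷ w) |π|≡|w| = cong (b ∷_) (map-proj₂-zip π w (suc-injective |π|≡|w|))

oddCycles≡oddBlocks : (π : List ℕ) (w : List Bool) → length π ≡ length w →
  oddCycles (π , w) ≡ oddBlocks (compartmentSizes (length π) π) w
oddCycles≡oddBlocks π w |π|≡|w| = begin
  oddCycles (π , w)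
    ≡⟨ length-filterᵇ _ (compartments (π , w)) ⟩
  ∑ (compartments (π , w)) (𝟙 ∘ oddᵇ ∘ minusCount)
    ≡⟨ cong (λ Cs → ∑ Cs (𝟙 ∘ oddᵇ ∘ minusCount)) (compartmentsFuel≡blocks (length π) (zip π w)) ⟩
  ∑ (blocks (compartmentSizes (length π) (map proj₁ (zip π w))) (zip π w)) (𝟙 ∘ oddᵇ ∘ minusCount)
    ≡⟨ cong (λ vs → ∑ (blocks (compartmentSizes (length π) vs) (zip π w)) (𝟙 ∘ oddᵇ ∘ minusCount))
            (map-proj₁-zip π w |π|≡|w|) ⟩
  ∑ (blocks S (zip π w)) (𝟙 ∘ oddᵇ ∘ minusCount)
    ≡⟨ ∑-cong (blocks S (zip π w)) (cong (𝟙 ∘ oddᵇ) ∘ minusCount≡minuses) ⟩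
  ∑ (blocks S (zip π w)) (𝟙 ∘ oddᵇ ∘ minuses ∘ map proj₂)
    ≡⟨ ∑-map (map proj₂) (blocks S (zip π w)) (𝟙 ∘ oddᵇ ∘ minuses) ⟨
  ∑ (map (map proj₂) (blocks S (zip π w))) (𝟙 ∘ oddᵇ ∘ minuses)
    ≡⟨ cong (λ Bs → ∑ Bs (𝟙 ∘ oddᵇ ∘ minuses))
            (trans (map-blocks proj₂ S (zip π w)) (cong (blocks S) (map-proj₂-zip π w |π|≡|w|))) ⟩
  oddBlocks S w ∎
  where
  open ≡-Reasoning
  S = compartmentSizes (length π) π

throughFirst-positive : ∀ m v vs → 1 ≤ throughFirst m (v ∷ vs)
throughFirst-positive m v vs with v ≡ᵇ m
... | true  = s≤s z≤n
... | false = s≤s z≤n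

throughFirst≤length : ∀ m vs → throughFirst m vs ≤ length vs
throughFirst≤length m []       = z≤n
throughFirst≤length m (v ∷ vs) with v ≡ᵇ m
... | true  = s≤s z≤n
... | false = s≤s (throughFirst≤length m vs)

length-drop-throughFirst : ∀ f v vs → length (v ∷ vs) ≤ suc f →
  length (drop (throughFirst (least (v ∷ vs)) (v ∷ vs)) (v ∷ vs)) ≤ f
length-drop-throughFirst f v vs (s≤s |vs|≤f) = begin
  length (drop k (v ∷ vs)) ≡⟨ length-drop k (v ∷ vs) ⟩
  suc (length vs) ∸ k      ≤⟨ ∸-monoʳ-≤ (suc (length vs)) (throughFirst-positive (least (v ∷ vs)) v vs) ⟩
  length vs                ≤⟨ |vs|≤f ⟩
  f                        ∎
  where
  open ≤-Reasoning
  k = throughFirst (least (v ∷ vs)) (v ∷ vs)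

compartmentSizes-positive : ∀ f vs → All (1 ≤_) (compartmentSizes f vs)
compartmentSizes-positive zero    vs       = []
compartmentSizes-positive (suc f) []       = []
compartmentSizes-positive (suc f) (v ∷ vs) = throughFirst-positive _ v vs ∷ compartmentSizes-positive f _

sum-compartmentSizes : ∀ f vs → length vs ≤ f → sum (compartmentSizes f vs) ≡ length vs
sum-compartmentSizes zero    []       _      = refl
sum-compartmentSizes (suc f) []       _      = refl
sum-compartmentSizes (suc f) (v ∷ vs) |vs|≤f = begin
  k + sum (compartmentSizes f (drop k (v ∷ vs)))
    ≡⟨ cong (k +_) (sum-compartmentSizes f _ (length-drop-throughFirst f v vs |vs|≤f)) ⟩
  k + length (drop k (v ∷ vs))
    ≡⟨ cong (k +_) (length-drop k (v ∷ vs)) ⟩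
  k + (length (v ∷ vs) ∸ k)
    ≡⟨ m+[n∸m]≡n (throughFirst≤length _ (v ∷ vs)) ⟩
  length (v ∷ vs) ∎
  where
  open ≡-Reasoning
  k = throughFirst (least (v ∷ vs)) (v ∷ vs)

insertAt : ℕ → ℕ → List ℕ → List ℕ
insertAt zero    m xs       = m ∷ xs
insertAt (suc t) m []       = m ∷ []
insertAt (suc t) m (x ∷ xs) = x ∷ insertAt t m xs

insertAt-↭ : ∀ t m xs → insertAt t m xs ↭ m ∷ xs
insertAt-↭ zero    m xs       = ↭-refl
insertAt-↭ (suc t) m []       = ↭-refl
insertAt-↭ (suc t) m (x ∷ xs) = ↭-trans (prep x (insertAt-↭ t m xs)) (swap x m ↭-refl)

insertAt-++ : ∀ m ys zs → insertAt (length ys) m (ys ++ zs) ≡ ys ++ m ∷ zs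
insertAt-++ m []       zs = refl
insertAt-++ m (y ∷ ys) zs = cong (y ∷_) (insertAt-++ m ys zs)

least-∈ : ∀ v vs → least (v ∷ vs) ∈ v ∷ vs
least-∈ v []       = here refl
least-∈ v (w ∷ ws) with v ≤ᵇ least (w ∷ ws)
... | true  = here refl
... | false = there (least-∈ w ws)

least-insertAt : ∀ t {m} v vs → All (_< m) (v ∷ vs) → least (insertAt t m (v ∷ vs)) ≡ least (v ∷ vs)
least-insertAt zero          {m} v vs       v∷vs<m
  rewrite dec-false (m ≤? least (v ∷ vs)) (<⇒≱ (All.lookup v∷vs<m (least-∈ v vs))) = refl
least-insertAt (suc zero)    {m} v []       (v<m ∷ []) rewrite dec-true (v ≤? m) (<⇒≤ v<m) = refl
least-insertAt (suc (suc t)) {m} v []       (v<m ∷ []) rewrite dec-true (v ≤? m) (<⇒≤ v<m) = refl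
least-insertAt (suc zero)        v (w ∷ ws) (_ ∷ w∷ws<m) =
  cong (λ l → if v ≤ᵇ l then v else l) (least-insertAt zero w ws w∷ws<m)
least-insertAt (suc (suc t))     v (w ∷ ws) (_ ∷ w∷ws<m) =
  cong (λ l → if v ≤ᵇ l then v else l) (least-insertAt (suc t) w ws w∷ws<m)

throughFirst-insertAt-before : ∀ {μ e} t vs → e ≢ μ → t < throughFirst μ vs →
  throughFirst μ (insertAt t e vs) ≡ suc (throughFirst μ vs) ×
  drop (suc (throughFirst μ vs)) (insertAt t e vs) ≡ drop (throughFirst μ vs) vs
throughFirst-insertAt-before {μ} {e} zero (v ∷ vs) e≢μ _ rewrite dec-false (e ≟ μ) e≢μ = refl , refl
throughFirst-insertAt-before {μ} (suc t) (v ∷ vs) e≢μ t<k with v ≡ᵇ μ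
... | true  = contradiction t<k λ { (s≤s ()) }
... | false with throughFirst-insertAt-before t vs e≢μ (s≤s⁻¹ t<k)
...   | tf≡ , drop≡ = cong suc tf≡ , drop≡

throughFirst-insertAt-after : ∀ {μ e} t vs → μ ∈ vs → throughFirst μ vs ≤ t →
  throughFirst μ (insertAt t e vs) ≡ throughFirst μ vs ×
  drop (throughFirst μ vs) (insertAt t e vs) ≡ insertAt (t ∸ throughFirst μ vs) e (drop (throughFirst μ vs) vs)
throughFirst-insertAt-after {μ} zero (v ∷ vs) _ k≤0 = contradiction k≤0 (<⇒≱ (throughFirst-positive μ v vs))
throughFirst-insertAt-after {μ} (suc t) (v ∷ vs) μ∈ k≤t with v ≡ᵇ μ in v≡ᵇμ
... | true = refl , refl
throughFirst-insertAt-after (suc t) (v ∷ vs) (here refl) _ | false =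
  contradiction (trans (sym v≡ᵇμ) (dec-true (v ≟ v) refl)) λ ()
throughFirst-insertAt-after (suc t) (v ∷ vs) (there μ∈) (s≤s k≤t) | false
  with throughFirst-insertAt-after t vs μ∈ k≤t
... | tf≡ , drop≡ = cong suc tf≡ , drop≡

compartmentSizes-fuel : ∀ f g vs → length vs ≤ f → length vs ≤ g → compartmentSizes f vs ≡ compartmentSizes g vs
compartmentSizes-fuel zero    zero    []       _      _      = refl
compartmentSizes-fuel zero    (suc g) []       _      _      = refl
compartmentSizes-fuel (suc f) zero    []       _      _      = refl
compartmentSizes-fuel (suc f) (suc g) []       _      _      = refl
compartmentSizes-fuel (suc f) (suc g) (v ∷ vs) |vs|≤f |vs|≤g = cong (_ ∷_)
  (compartmentSizes-fuel f g _ (length-drop-throughFirst f v vs |vs|≤f) (length-drop-throughFirst g v vs |vs|≤g))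

compartmentSizes-step : ∀ f L → L ≢ [] →
  compartmentSizes (suc f) L ≡ throughFirst (least L) L ∷ compartmentSizes f (drop (throughFirst (least L) L) L)
compartmentSizes-step f []      []≢[] = contradiction refl []≢[]
compartmentSizes-step f (_ ∷ _) _     = refl

insertAt-≢[] : ∀ t m xs → insertAt t m xs ≢ []
insertAt-≢[] zero    m xs       ()
insertAt-≢[] (suc t) m []       ()
insertAt-≢[] (suc t) m (x ∷ xs) ()

≡ᵇ-∸ : ∀ {t L p} → p ≤ t → p ≤ L → (t ∸ p ≡ᵇ L ∸ p) ≡ (t ≡ᵇ L)
≡ᵇ-∸ {t} {L} {p} p≤t p≤L = does-⇔ (mk⇔ (∸-cancelʳ-≡ p≤t p≤L) (cong (_∸ p))) (t ∸ p ≟ L ∸ p) (t ≟ L)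

-- A new largest value starts a compartment of its own exactly when it is placed last;
-- anywhere else it joins the compartment it lands in.
compartmentCount-insertAt : ∀ {m} f vs t → All (_< m) vs → t ≤ length vs → length vs ≤ f →
  length (compartmentSizes (suc f) (insertAt t m vs)) ≡ 𝟙 (t ≡ᵇ length vs) + length (compartmentSizes f vs)
compartmentCount-insertAt {m} f [] zero [] _ _ rewrite dec-true (m ≟ m) refl = refl
compartmentCount-insertAt {m} (suc f) (v ∷ vs) t vs<m t≤ |vs|≤f
  rewrite compartmentSizes-step (suc f) (insertAt t m (v ∷ vs)) (insertAt-≢[] t m (v ∷ vs))
        | least-insertAt t v vs vs<m
  with t <? throughFirst (least (v ∷ vs)) (v ∷ vs)
... | yes t<k
  with throughFirst-insertAt-before t (v ∷ vs) (<⇒≢ (All.lookup vs<m (least-∈ v vs)) ∘ sym) t<k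
...   | tf≡ , drop≡ rewrite tf≡ | drop≡
                          | dec-false (t ≟ length (v ∷ vs)) (<⇒≢ (<-≤-trans t<k (throughFirst≤length _ (v ∷ vs)))) =
  cong (suc ∘ length) (compartmentSizes-fuel (suc f) f _ (m≤n⇒m≤1+n |R|≤f) |R|≤f)
  where |R|≤f = length-drop-throughFirst f v vs |vs|≤f
compartmentCount-insertAt {m} (suc f) (v ∷ vs) t vs<m t≤ |vs|≤f | no t≮k
  with throughFirst-insertAt-after {e = m} t (v ∷ vs) (least-∈ v vs) (≮⇒≥ t≮k)
...   | tf≡ , drop≡ rewrite tf≡ | drop≡ = begin
  suc (length (compartmentSizes (suc f) (insertAt (t ∸ k) m R)))
    ≡⟨ cong suc (compartmentCount-insertAt f R (t ∸ k) (AllP.drop⁺ k vs<m) t∸k≤ |R|≤f) ⟩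
  suc (𝟙 (t ∸ k ≡ᵇ length R) + length (compartmentSizes f R))
    ≡⟨ cong (λ b → suc (𝟙 b + length (compartmentSizes f R)))
            (trans (cong (t ∸ k ≡ᵇ_) (length-drop k (v ∷ vs))) (≡ᵇ-∸ (≮⇒≥ t≮k) (throughFirst≤length _ (v ∷ vs)))) ⟩
  suc (𝟙 (t ≡ᵇ length (v ∷ vs)) + length (compartmentSizes f R))
    ≡⟨ +-suc _ _ ⟨
  𝟙 (t ≡ᵇ length (v ∷ vs)) + suc (length (compartmentSizes f R)) ∎
  where
  open ≡-Reasoning
  k = throughFirst (least (v ∷ vs)) (v ∷ vs)
  R = drop k (v ∷ vs)
  |R|≤f = length-drop-throughFirst f v vs |vs|≤f
  t∸k≤ : t ∸ k ≤ length R
  t∸k≤ = subst (t ∸ k ≤_) (sym (length-drop k (v ∷ vs))) (∸-monoˡ-≤ k t≤)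

-- Permutations of [n] as lists

InRange : ℕ → ℕ → Set
InRange n x = 1 ≤ x × x ≤ n

record IsPerm (n : ℕ) (π : List ℕ) : Set where
  constructor isPerm
  field
    length≡ : length π ≡ n
    inRange : All (InRange n) π
    unique  : Unique π

∈-range1⁺ : ∀ {n x} → InRange n x → x ∈ range1 n
∈-range1⁺ {x = suc y} (_ , y<n) = ∈-map⁺ suc (∈-upTo⁺ y<n)

∈-range1⁻ : ∀ {n x} → x ∈ range1 n → InRange n x
∈-range1⁻ x∈ with y , y∈ , refl ← ∈-map⁻ suc x∈ = s≤s z≤n , ∈-upTo⁻ y∈

length-range1 : ∀ n → length (range1 n) ≡ n
length-range1 n = trans (length-map suc (upTo n)) (length-upTo n)

range1-unique : ∀ n → Unique (range1 n)
range1-unique n = Unique.map⁺ suc-injective (Unique.upTo⁺ n)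

Unique-resp-↭ : {xs ys : List ℕ} → xs ↭ ys → Unique xs → Unique ys
Unique-resp-↭ xs↭ys = PermSetoid.AllPairs-resp-↭ (setoid ℕ) ≢-sym (resp₂ _≢_) (↭⇒↭ₛ xs↭ys)

-- The pigeonhole principle: xs is, up to order, the sublist of range1 k of its own members.
unique-inRange-length≤ : ∀ {k xs} → Unique xs → All (InRange k) xs → length xs ≤ k
unique-inRange-length≤ {k} {xs} uxs xs⊆ = begin
  length xs                           ≡⟨ ↭-length (∼bag⇒↭ (unique∧set⇒bag uxs u-members (mk⇔ to from))) ⟩
  length (filter (_∈? xs) (range1 k)) ≤⟨ length-filter (_∈? xs) (range1 k) ⟩
  length (range1 k)                   ≡⟨ length-range1 k ⟩
  k                                   ∎
  where
  open ≤-Reasoning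
  u-members = Unique.filter⁺ (_∈? xs) (range1-unique k)
  to : ∀ {x} → x ∈ xs → x ∈ filter (_∈? xs) (range1 k)
  to x∈ = ∈-filter⁺ (_∈? xs) (∈-range1⁺ (All.lookup xs⊆ x∈)) x∈
  from : ∀ {x} → x ∈ filter (_∈? xs) (range1 k) → x ∈ xs
  from x∈ = proj₂ (∈-filter⁻ (_∈? xs) {xs = range1 k} x∈)

concatMap≡cartesianProductWith : {C : Set} (f : A → B → C) (xs : List A) (ys : List B) →
  concatMap (λ x → map (f x) ys) xs ≡ cartesianProductWith f xs ys
concatMap≡cartesianProductWith f []       ys = refl
concatMap≡cartesianProductWith f (x ∷ xs) ys = cong (map (f x) ys ++_) (concatMap≡cartesianProductWith f xs ys)

words-suc : ∀ n k → words n (suc k) ≡ cartesianProductWith _∷_ (range1 n) (words n k)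
words-suc n k = concatMap≡cartesianProductWith _∷_ (range1 n) (words n k)

words-unique : ∀ n k → Unique (words n k)
words-unique n zero    = [] ∷ []
words-unique n (suc k) = subst Unique (sym (words-suc n k))
  (Unique.cartesianProductWith⁺ _∷_ ∷-injective (range1-unique n) (words-unique n k))

∈-words⁺ : ∀ {n k π} → length π ≡ k → All (InRange n) π → π ∈ words n k
∈-words⁺ {k = zero}  {[]}    refl [] = here refl
∈-words⁺ {n} {suc k} {x ∷ π} |π|≡ (x∈ ∷ π⊆) = subst (x ∷ π ∈_) (sym (words-suc n k))
  (∈-cartesianProductWith⁺ _∷_ (∈-range1⁺ x∈) (∈-words⁺ (suc-injective |π|≡) π⊆))

∈-words⁻ : ∀ {n} k {π} → π ∈ words n k → length π ≡ k × All (InRange n) π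
∈-words⁻ zero    (here refl) = refl , []
∈-words⁻ {n} (suc k) π∈
  with x , ρ , x∈ , ρ∈ , refl ← ∈-cartesianProductWith⁻ _∷_ (range1 n) (words n k) (subst (_ ∈_) (words-suc n k) π∈)
  with |ρ|≡ , ρ⊆ ← ∈-words⁻ k ρ∈ = cong suc |ρ|≡ , ∈-range1⁻ x∈ ∷ ρ⊆

distinctᵇ⇒unique : ∀ xs → T (distinctᵇ xs) → Unique xs
distinctᵇ⇒unique []       _ = []
distinctᵇ⇒unique (x ∷ xs) t with fresh , rest ← Equivalence.to T-∧ t =
  All.tabulate (λ y∈ x≡y → subst T (Equivalence.to T-not-≡ fresh)
                              (any⁺ (x ≡ᵇ_) (AnyM.map (λ y≡z → ≡⇒≡ᵇ x _ (trans x≡y y≡z)) y∈)))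
  ∷ distinctᵇ⇒unique xs rest

unique⇒distinctᵇ : ∀ {xs} → Unique xs → T (distinctᵇ xs)
unique⇒distinctᵇ []               = _
unique⇒distinctᵇ {x ∷ xs} (x∉ ∷ uxs) = Equivalence.from T-∧
  ( Equivalence.from T-not-≡ (dec-false (T? (any (x ≡ᵇ_) xs))
      (AllP.All¬⇒¬Any (All.map (λ x≢y → x≢y ∘ ≡ᵇ⇒≡ x _) x∉) ∘ any⁻ (x ≡ᵇ_) xs))
  , unique⇒distinctᵇ uxs)

perms-unique : ∀ n → Unique (perms n)
perms-unique n = Unique.filter⁺ (T? ∘ distinctᵇ) (words-unique n n)

∈-perms⁺ : ∀ {n π} → IsPerm n π → π ∈ perms n
∈-perms⁺ (isPerm |π|≡ π⊆ uπ) = ∈-filter⁺ (T? ∘ distinctᵇ) (∈-words⁺ |π|≡ π⊆) (unique⇒distinctᵇ uπ)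

∈-perms⁻ : ∀ {n π} → π ∈ perms n → IsPerm n π
∈-perms⁻ {n} {π} π∈ with π∈w , t ← ∈-filter⁻ (T? ∘ distinctᵇ) {xs = words n n} π∈
  with |π|≡ , π⊆ ← ∈-words⁻ n π∈w = isPerm |π|≡ π⊆ (distinctᵇ⇒unique π t)

inRange-shrink : ∀ {n x} → InRange (suc n) x → x ≢ suc n → InRange n x
inRange-shrink (1≤x , x≤1+n) x≢1+n = 1≤x , s≤s⁻¹ (≤∧≢⇒< x≤1+n x≢1+n)

inRange-suc≢ : ∀ {n x} → InRange n x → suc n ≢ x
inRange-suc≢ (_ , x≤n) 1+n≡x = <⇒≱ (s≤s x≤n) (≤-reflexive 1+n≡x)

IsPerm-cons : ∀ {n ρ π} → IsPerm n π → ρ ↭ suc n ∷ π → IsPerm (suc n) ρ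
IsPerm-cons (isPerm |π|≡ π⊆ uπ) ρ↭ = isPerm
  (trans (↭-length ρ↭) (cong suc |π|≡))
  (PermProp.All-resp-↭ (↭-sym ρ↭) ((s≤s z≤n , ≤-refl) ∷ All.map (map₂ m≤n⇒m≤1+n) π⊆))
  (Unique-resp-↭ (↭-sym ρ↭) (All.map inRange-suc≢ π⊆ ∷ uπ))

IsPerm-uncons : ∀ {n ρ π} → IsPerm (suc n) ρ → ρ ↭ suc n ∷ π → IsPerm n π
IsPerm-uncons (isPerm |ρ|≡ ρ⊆ uρ) ρ↭
  with _ ∷ π⊆ ← PermProp.All-resp-↭ ρ↭ ρ⊆
  with π∌ ∷ uπ ← Unique-resp-↭ ρ↭ uρ = isPerm
  (suc-injective (trans (sym (↭-length ρ↭)) |ρ|≡))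
  (All.zipWith (λ (x∈ , 1+n≢x) → inRange-shrink x∈ (≢-sym 1+n≢x)) (π⊆ , π∌))
  uπ

IsPerm-position≤ : ∀ {n t π} → t ≤ n → IsPerm n π → t ≤ length π
IsPerm-position≤ t≤ π-perm = subst (_ ≤_) (sym (IsPerm.length≡ π-perm)) t≤

IsPerm-length≤ : ∀ {n t π} → IsPerm n π → t ≤ length π → t ≤ n
IsPerm-length≤ π-perm t≤ = subst (_ ≤_) (IsPerm.length≡ π-perm) t≤

IsPerm-max∉ : ∀ {n π} → IsPerm n π → All (suc n ≢_) π
IsPerm-max∉ π-perm = All.map inRange-suc≢ (IsPerm.inRange π-perm)

max∈IsPerm : ∀ {n ρ} → IsPerm (suc n) ρ → suc n ∈ ρ
max∈IsPerm {n} {ρ} (isPerm |ρ|≡ ρ⊆ uρ) with suc n ∈? ρ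
... | yes 1+n∈ = 1+n∈
... | no  1+n∉ = contradiction (unique-inRange-length≤ uρ ρ⊆′) (<⇒≱ (≤-reflexive (sym |ρ|≡)))
  where
  ρ⊆′ : All (InRange n) ρ
  ρ⊆′ = All.tabulate λ x∈ → inRange-shrink (All.lookup ρ⊆ x∈) λ { refl → 1+n∉ x∈ }

-- A bijection Sₙ × {0,…,n} → Sₙ₊₁, presented as a way of extending π by the new entry n+1.
record Extension (n : ℕ) : Set where
  field
    extend      : ℕ → List ℕ → List ℕ
    extend-perm : ∀ {t π} → t ≤ n → IsPerm n π → IsPerm (suc n) (extend t π)
    injective   : ∀ {t t′ π π′} → t ≤ n → t′ ≤ n → IsPerm n π → IsPerm n π′ →
                  extend t π ≡ extend t′ π′ → t ≡ t′ × π ≡ π′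
    surjective  : ∀ {ρ} → IsPerm (suc n) ρ → ∃ λ t → ∃ λ π → t ≤ n × IsPerm n π × extend t π ≡ ρ

∑-perms-suc : ∀ {n} (E : Extension n) (F : List ℕ → ℕ) →
  ∑ (perms (suc n)) F ≡ ∑ (perms n) (λ π → ∑ (upTo (suc n)) (λ t → F (Extension.extend E t π)))
∑-perms-suc {n} E F = begin
  ∑ (perms (suc n)) F
    ≡⟨ ∑-reindex (λ (π , t) → extend t π) (Unique.cartesianProduct⁺ (perms-unique n) (Unique.upTo⁺ (suc n)))
         (perms-unique (suc n)) inj into onto F ⟩
  ∑ pairs (λ (π , t) → F (extend t π))
    ≡⟨ ∑-cartesianProduct (perms n) (upTo (suc n)) (λ (π , t) → F (extend t π)) ⟩
  ∑ (perms n) (λ π → ∑ (upTo (suc n)) (λ t → F (extend t π))) ∎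
  where
  open ≡-Reasoning
  open Extension E
  pairs = cartesianProduct (perms n) (upTo (suc n))
  members : ∀ {π t} → (π , t) ∈ pairs → t ≤ n × IsPerm n π
  members p∈ with π∈ , t∈ ← ∈-cartesianProduct⁻ (perms n) (upTo (suc n)) p∈ = s≤s⁻¹ (∈-upTo⁻ t∈) , ∈-perms⁻ π∈
  inj : ∀ {p p′} → p ∈ pairs → p′ ∈ pairs → extend (proj₂ p) (proj₁ p) ≡ extend (proj₂ p′) (proj₁ p′) → p ≡ p′
  inj p∈ p′∈ eq with t≤ , π-perm ← members p∈ | t′≤ , π′-perm ← members p′∈
    with refl , refl ← injective t≤ t′≤ π-perm π′-perm eq = refl
  into : ∀ {p} → p ∈ pairs → extend (proj₂ p) (proj₁ p) ∈ perms (suc n)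
  into p∈ with t≤ , π-perm ← members p∈ = ∈-perms⁺ (extend-perm t≤ π-perm)
  onto : ∀ {ρ} → ρ ∈ perms (suc n) → ∃ λ p → p ∈ pairs × extend (proj₂ p) (proj₁ p) ≡ ρ
  onto ρ∈ with t , π , t≤ , π-perm , refl ← surjective (∈-perms⁻ ρ∈) =
    (π , t) , ∈-cartesianProduct⁺ (∈-perms⁺ π-perm) (∈-upTo⁺ (s≤s t≤)) , refl

-- Statistics distributed like the number of cycles

-- stirlingSum n h = Σᵢ c(n,i) h(i), computed through c(n+1,i+1) = n c(n,i+1) + c(n,i).
stirlingSum : ℕ → (ℕ → ℕ) → ℕ
stirlingSum zero    h = h 0
stirlingSum (suc n) h = n * stirlingSum n h + stirlingSum n (h ∘ suc)

∑-upTo-last : ∀ n (g : Bool → ℕ) → ∑ (upTo (suc n)) (λ t → g (t ≡ᵇ n)) ≡ n * g false + g true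
∑-upTo-last n g = begin
  ∑ (upTo (suc n)) (λ t → g (t ≡ᵇ n))              ≡⟨ cong (λ ts → ∑ ts (λ t → g (t ≡ᵇ n))) (upTo-∷ʳ n) ⟨
  ∑ (upTo n ∷ʳ n) (λ t → g (t ≡ᵇ n))               ≡⟨ ∑-++ (upTo n) (n ∷ []) _ ⟩
  ∑ (upTo n) (λ t → g (t ≡ᵇ n)) + (g (n ≡ᵇ n) + 0) ≡⟨ cong₂ _+_ before last ⟩
  n * g false + g true                               ∎
  where
  open ≡-Reasoning
  before : ∑ (upTo n) (λ t → g (t ≡ᵇ n)) ≡ n * g false
  before = begin
    ∑ (upTo n) (λ t → g (t ≡ᵇ n)) ≡⟨ ∑-∈-cong (upTo n) (λ t∈ → cong g (dec-false (_ ≟ n) (<⇒≢ (∈-upTo⁻ t∈)))) ⟩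
    ∑ (upTo n) (λ _ → g false)    ≡⟨ ∑-const (upTo n) (g false) ⟩
    length (upTo n) * g false     ≡⟨ cong (_* g false) (length-upTo n) ⟩
    n * g false                   ∎
  last : g (n ≡ᵇ n) + 0 ≡ g true
  last = trans (+-identityʳ _) (cong g (dec-true (n ≟ n) refl))

record StirlingStatistic (st : ℕ → List ℕ → ℕ) : Set where
  field
    st-[]     : st 0 [] ≡ 0
    extension : ∀ n → Extension n
    st-extend : ∀ n {t π} → t ≤ n → IsPerm n π →
                st (suc n) (Extension.extend (extension n) t π) ≡ 𝟙 (t ≡ᵇ n) + st n π

∑-perms≡stirlingSum : ∀ {st} → StirlingStatistic st → ∀ n (h : ℕ → ℕ) →
  ∑ (perms n) (h ∘ st n) ≡ stirlingSum n h
∑-perms≡stirlingSum S zero    h = trans (+-identityʳ _) (cong h (StirlingStatistic.st-[] S))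
∑-perms≡stirlingSum {st} S (suc n) h = begin
  ∑ (perms (suc n)) (h ∘ st (suc n))
    ≡⟨ ∑-perms-suc (extension n) (h ∘ st (suc n)) ⟩
  ∑ (perms n) (λ π → ∑ (upTo (suc n)) (λ t → h (st (suc n) (Extension.extend (extension n) t π))))
    ≡⟨ ∑-∈-cong (perms n) (λ π∈ → ∑-∈-cong (upTo (suc n)) (λ t∈ →
         cong h (st-extend n (s≤s⁻¹ (∈-upTo⁻ t∈)) (∈-perms⁻ π∈)))) ⟩
  ∑ (perms n) (λ π → ∑ (upTo (suc n)) (λ t → h (𝟙 (t ≡ᵇ n) + st n π)))
    ≡⟨ ∑-cong (perms n) (λ π → ∑-upTo-last n (λ b → h (𝟙 b + st n π))) ⟩
  ∑ (perms n) (λ π → n * h (st n π) + h (suc (st n π)))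
    ≡⟨ ∑-+ (perms n) _ _ ⟩
  ∑ (perms n) (λ π → n * h (st n π)) + ∑ (perms n) (h ∘ suc ∘ st n)
    ≡⟨ cong₂ _+_ (trans (∑-*ˡ (perms n) n (h ∘ st n)) (cong (n *_) (∑-perms≡stirlingSum S n h)))
                 (∑-perms≡stirlingSum S n (h ∘ suc)) ⟩
  stirlingSum (suc n) h ∎
  where
  open ≡-Reasoning
  open StirlingStatistic S

insertAt-injective : ∀ {m t t′ π π′} → t ≤ length π → t′ ≤ length π′ → All (m ≢_) π → All (m ≢_) π′ →
  insertAt t m π ≡ insertAt t′ m π′ → t ≡ t′ × π ≡ π′
insertAt-injective {t = zero}  {zero}               _ _ _         _         refl = refl , refl
insertAt-injective {t = zero}  {suc _} {π′ = _ ∷ _} _ _ _         (m≢x ∷ _) refl = contradiction refl m≢x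
insertAt-injective {t = suc _} {zero}  {_ ∷ _}      _ _ (m≢x ∷ _) _         refl = contradiction refl m≢x
insertAt-injective {t = suc _} {suc _} {_ ∷ _} {_ ∷ _} (s≤s t≤) (s≤s t′≤) (_ ∷ π∌) (_ ∷ π′∌) eq
  with refl , eq′ ← ∷-injective eq
  with refl , refl ← insertAt-injective t≤ t′≤ π∌ π′∌ eq′ = refl , refl

insertion : ∀ n → Extension n
insertion n = record
  { extend      = λ t π → insertAt t (suc n) π
  ; extend-perm = λ {t} {π} _ π-perm → IsPerm-cons π-perm (insertAt-↭ t (suc n) π)
  ; injective   = λ t≤ t′≤ π-perm π′-perm → insertAt-injective
      (IsPerm-position≤ t≤ π-perm) (IsPerm-position≤ t′≤ π′-perm) (IsPerm-max∉ π-perm) (IsPerm-max∉ π′-perm)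
  ; surjective  = surjective
  }
  where
  surjective : ∀ {ρ} → IsPerm (suc n) ρ → ∃ λ t → ∃ λ π → t ≤ n × IsPerm n π × insertAt t (suc n) π ≡ ρ
  surjective ρ-perm with ys , zs , refl ← ∈-∃++ (max∈IsPerm ρ-perm) =
    length ys , ys ++ zs , IsPerm-length≤ π-perm (length-++-≤ˡ ys) , π-perm , insertAt-++ (suc n) ys zs
    where
    π-perm : IsPerm n (ys ++ zs)
    π-perm = IsPerm-uncons ρ-perm (PermProp.shift (suc n) ys zs)

compartmentCount-stirling : StirlingStatistic compartmentCount
compartmentCount-stirling = record
  { st-[]     = refl
  ; extension = insertion
  ; st-extend = λ n {t} {π} t≤ (isPerm |π|≡ π⊆ _) → begin
      compartmentCount (suc n) (insertAt t (suc n) π)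
        ≡⟨ compartmentCount-insertAt n π t (All.map (s≤s ∘ proj₂) π⊆) (subst (t ≤_) (sym |π|≡) t≤)
                                      (≤-reflexive |π|≡) ⟩
      𝟙 (t ≡ᵇ length π) + compartmentCount n π
        ≡⟨ cong (λ l → 𝟙 (t ≡ᵇ l) + compartmentCount n π) |π|≡ ⟩
      𝟙 (t ≡ᵇ n) + compartmentCount n π ∎
  }
  where open ≡-Reasoning

-- Orbits of a permutation

app-∈ : ∀ {x π} → x < length π → app π (suc x) ∈ π
app-∈ {zero}  {_ ∷ _} _          = here refl
app-∈ {suc x} {_ ∷ π} (s≤s x<) = there (app-∈ x<)

app-injective : ∀ {x x′ π} → Unique π → x < length π → x′ < length π → app π (suc x) ≡ app π (suc x′) → x ≡ x′
app-injective {zero}  {zero}           _        _        _         _  = refl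
app-injective {zero}  {suc x′} {_ ∷ π} (y∉ ∷ _) _        (s≤s x′<) eq = contradiction eq (All.lookup y∉ (app-∈ x′<))
app-injective {suc x} {zero}   {_ ∷ π} (y∉ ∷ _) (s≤s x<) _         eq = contradiction eq (≢-sym (All.lookup y∉ (app-∈ x<)))
app-injective {suc x} {suc x′} {_ ∷ π} (_ ∷ uπ) (s≤s x<) (s≤s x′<) eq = cong suc (app-injective uπ x< x′< eq)

iter-below-period : ∀ {π i p} → 1 ≤ p → iter π p i ≡ i → ∀ k → ∃ λ k′ → k′ < p × iter π k i ≡ iter π k′ i
iter-below-period 1≤p πᵖi≡i zero    = 0 , 1≤p , refl
iter-below-period {π} {i} {p} 1≤p πᵖi≡i (suc k) with k′ , k′<p , eq ← iter-below-period 1≤p πᵖi≡i k with suc k′ <? p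
... | yes 1+k′<p = suc k′ , 1+k′<p , cong (app π) eq
... | no  1+k′≮p = 0 , 1≤p ,
  trans (cong (app π) eq) (trans (cong (λ q → iter π q i) (≤-antisym k′<p (≮⇒≥ 1+k′≮p))) πᵖi≡i)

module _ {n π} (π-perm : IsPerm n π) where
  open IsPerm π-perm

  private
    index< : ∀ {x} → InRange n (suc x) → x < length π
    index< (_ , 1+x≤n) = subst (_ ≤_) (sym length≡) 1+x≤n

  app-inRange : ∀ {y} → InRange n y → InRange n (app π y)
  app-inRange {suc x} y∈ = All.lookup inRange (app-∈ (index< y∈))

  iter-inRange : ∀ {i} k → InRange n i → InRange n (iter π k i)
  iter-inRange zero    i∈ = i∈
  iter-inRange (suc k) i∈ = app-inRange (iter-inRange k i∈)

  app-injectiveᴾ : ∀ {y z} → InRange n y → InRange n z → app π y ≡ app π z → y ≡ z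
  app-injectiveᴾ {suc x} {suc x′} y∈ z∈ eq = cong suc (app-injective unique (index< y∈) (index< z∈) eq)

  iter-injective : ∀ {i j} k → InRange n i → InRange n j → iter π k i ≡ iter π k j → i ≡ j
  iter-injective zero    _  _  eq = eq
  iter-injective (suc k) i∈ j∈ eq =
    iter-injective k i∈ j∈ (app-injectiveᴾ (iter-inRange k i∈) (iter-inRange k j∈) eq)

  iter-+ : ∀ a d i → iter π (a + d) i ≡ iter π a (iter π d i)
  iter-+ zero    d i = refl
  iter-+ (suc a) d i = cong (app π) (iter-+ a d i)

  -- The n+1 points i, π i, …, πⁿ i of [n] cannot all be distinct, and π is injective.
  period : ∀ {i} → InRange n i → ∃ λ p → InRange n p × iter π p i ≡ i
  period {i} i∈ with any? (λ p → iter π p i ≟ i) (range1 n)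
  ... | yes returns = let p , p∈ , πᵖi≡i = Membership.find returns in p , ∈-range1⁻ p∈ , πᵖi≡i
  ... | no  never   =
    contradiction (unique-inRange-length≤ orbit-unique orbit-inRange) (<⇒≱ (≤-reflexive (sym |orbit|)))
    where
    orbit = map (λ k → iter π k i) (upTo (suc n))
    |orbit| : length orbit ≡ suc n
    |orbit| = trans (length-map _ (upTo (suc n))) (length-upTo (suc n))
    orbit-inRange : All (InRange n) orbit
    orbit-inRange = AllP.map⁺ (All.tabulate {xs = upTo (suc n)} (λ {k} _ → iter-inRange k i∈))
    no-return : ∀ {a c} → a < c → c ≤ n → iter π a i ≢ iter π c i
    no-return {a} {c} a<c c≤n πᵃi≡πᶜi = never (AnyM.map (λ d≡p → subst (λ q → iter π q i ≡ i) d≡p (sym i≡πᵈi))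
                                                        (∈-range1⁺ (m<n⇒0<n∸m a<c , ≤-trans (m∸n≤m c a) c≤n)))
      where
      i≡πᵈi : i ≡ iter π (c ∸ a) i
      i≡πᵈi = iter-injective a i∈ (iter-inRange (c ∸ a) i∈)
        (trans πᵃi≡πᶜi (trans (cong (λ c → iter π c i) (sym (m+[n∸m]≡n (<⇒≤ a<c)))) (iter-+ a (c ∸ a) i)))
    orbit-unique : Unique orbit
    orbit-unique = map-unique _ (Unique.upTo⁺ (suc n)) λ {a} {c} a∈ c∈ eq → case a c (∈-upTo⁻ a∈) (∈-upTo⁻ c∈) eq
      where
      case : ∀ a c → a < suc n → c < suc n → iter π a i ≡ iter π c i → a ≡ c
      case a c _ c≤n eq with <-cmp a c
      ... | tri< a<c _ _ = contradiction eq (no-return a<c (s≤s⁻¹ c≤n))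
      ... | tri≈ _ a≡c _ = a≡c
      case a c a≤n _ eq | tri> _ _ c<a = contradiction (sym eq) (no-return c<a (s≤s⁻¹ a≤n))

  iter-below-n : ∀ {i} → InRange n i → ∀ k → ∃ λ k′ → k′ < n × iter π k i ≡ iter π k′ i
  iter-below-n i∈ k with p , (1≤p , p≤n) , πᵖi≡i ← period i∈ with k′ , k′<p , eq ← iter-below-period 1≤p πᵖi≡i k =
    k′ , <-≤-trans k′<p p≤n , eq

  isCycleMin⇔ : ∀ {i} → InRange n i → T (isCycleMin n π i) ⇔ (∀ k → i ≤ iter π k i)
  isCycleMin⇔ {i} i∈ = mk⇔
    (λ t k → let k′ , k′<n , eq = iter-below-n i∈ k in
      subst (i ≤_) (sym eq) (≤ᵇ⇒≤ i _ (All.lookup (AllP.all⁺ (λ k → i ≤ᵇ iter π k i) (upTo n) t) (∈-upTo⁺ k′<n))))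
    (λ i≤ → AllP.all⁻ (λ k → i ≤ᵇ iter π k i) (All.tabulate {xs = upTo n} λ {k} _ → ≤⇒≤ᵇ (i≤ k)))

-- ρ agrees with π on [n], except that it may reroute one arrow y ↦ π y through the new point n+1.
Detour : ℕ → List ℕ → List ℕ → Set
Detour n π ρ = ∀ {y} → InRange n y → app ρ y ≡ app π y ⊎ (app ρ y ≡ suc n × app ρ (suc n) ≡ app π y)

module _ {n π ρ} (π-perm : IsPerm n π) (ρ-perm : IsPerm (suc n) ρ) (detour : Detour n π ρ) where

  iter-detour⇒ : ∀ {i} → InRange n i → ∀ k →
    (∃ λ k′ → iter ρ k i ≡ iter π k′ i) ⊎ (iter ρ k i ≡ suc n × ∃ λ k′ → app ρ (suc n) ≡ iter π k′ i)
  iter-detour⇒ i∈ zero = inj₁ (0 , refl)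
  iter-detour⇒ i∈ (suc k) with iter-detour⇒ i∈ k
  ... | inj₂ (ρᵏi≡new , k′ , eq) = inj₁ (k′ , trans (cong (app ρ) ρᵏi≡new) eq)
  ... | inj₁ (k′ , eq) with detour (iter-inRange π-perm k′ i∈)
  ...   | inj₁ same             = inj₁ (suc k′ , trans (cong (app ρ) eq) same)
  ...   | inj₂ (to-new , from-new) = inj₂ (trans (cong (app ρ) eq) to-new , suc k′ , from-new)

  iter-detour⇐ : ∀ {i} → InRange n i → ∀ k → ∃ λ k″ → iter π k i ≡ iter ρ k″ i
  iter-detour⇐ i∈ zero = 0 , refl
  iter-detour⇐ i∈ (suc k) with k″ , eq ← iter-detour⇐ i∈ k with detour (iter-inRange π-perm k i∈)
  ... | inj₁ same             = suc k″ , trans (sym same) (cong (app ρ) eq)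
  ... | inj₂ (to-new , from-new) =
    suc (suc k″) , trans (sym from-new) (cong (app ρ) (trans (sym to-new) (cong (app ρ) eq)))

  minimal-detour⇒ : ∀ {i} → InRange n i → (∀ k → i ≤ iter π k i) → ∀ k → i ≤ iter ρ k i
  minimal-detour⇒ i∈ i≤ k with iter-detour⇒ i∈ k
  ... | inj₁ (k′ , eq) = subst (_ ≤_) (sym eq) (i≤ k′)
  ... | inj₂ (eq , _)  = subst (_ ≤_) (sym eq) (m≤n⇒m≤1+n (proj₂ i∈))

  minimal-detour⇐ : ∀ {i} → InRange n i → (∀ k → i ≤ iter ρ k i) → ∀ k → i ≤ iter π k i
  minimal-detour⇐ i∈ i≤ k with k″ , eq ← iter-detour⇐ i∈ k = subst (_ ≤_) (sym eq) (i≤ k″)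

  isCycleMin-detour : ∀ {i} → InRange n i → isCycleMin (suc n) ρ i ≡ isCycleMin n π i
  isCycleMin-detour i∈ = does-⇔ (mk⇔
    (Equivalence.from (isCycleMin⇔ π-perm i∈) ∘ minimal-detour⇐ i∈ ∘ Equivalence.to (isCycleMin⇔ ρ-perm i∈′))
    (Equivalence.from (isCycleMin⇔ ρ-perm i∈′) ∘ minimal-detour⇒ i∈ ∘ Equivalence.to (isCycleMin⇔ π-perm i∈)))
    (T? _) (T? _)
    where i∈′ = map₂ m≤n⇒m≤1+n i∈

-- Replace the entry at position t (counting from 0) by m and return the displaced entry;
-- past the end nothing is replaced and m itself comes back.
swapOut : ℕ → ℕ → List ℕ → List ℕ × ℕ
swapOut t       m []       = [] , m
swapOut zero    m (x ∷ xs) = m ∷ xs , x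
swapOut (suc t) m (x ∷ xs) = map₁ (x ∷_) (swapOut t m xs)

-- For t < n the new point n+1 enters the cycle of t+1 right after it; for t = n it is a fixed point.
cycleInsert : ℕ → ℕ → List ℕ → List ℕ
cycleInsert t m π = uncurry _∷ʳ_ (swapOut t m π)

swapOut-↭ : ∀ t m π → proj₂ (swapOut t m π) ∷ proj₁ (swapOut t m π) ↭ m ∷ π
swapOut-↭ t       m []       = ↭-refl
swapOut-↭ zero    m (x ∷ xs) = swap x m ↭-refl
swapOut-↭ (suc t) m (x ∷ xs) = ↭-trans (swap _ x ↭-refl) (↭-trans (prep x (swapOut-↭ t m xs)) (swap x m ↭-refl))

cycleInsert-↭ : ∀ t m π → cycleInsert t m π ↭ m ∷ π
cycleInsert-↭ t m π = ↭-trans (↭-sym (PermProp.∷↭∷ʳ _ _)) (swapOut-↭ t m π)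

length-swapOut : ∀ t m π → length (proj₁ (swapOut t m π)) ≡ length π
length-swapOut t       m []       = refl
length-swapOut zero    m (x ∷ xs) = refl
length-swapOut (suc t) m (x ∷ xs) = cong suc (length-swapOut t m xs)

swapOut-length : ∀ m π → swapOut (length π) m π ≡ (π , m)
swapOut-length m []       = refl
swapOut-length m (x ∷ xs) = cong (map₁ (x ∷_)) (swapOut-length m xs)

swapOut-++ : ∀ m ys v zs → swapOut (length ys) m (ys ++ v ∷ zs) ≡ (ys ++ m ∷ zs , v)
swapOut-++ m []       v zs = refl
swapOut-++ m (y ∷ ys) v zs = cong (map₁ (y ∷_)) (swapOut-++ m ys v zs)

swapOut-injective : ∀ {m t t′ π π′} → t ≤ length π → t′ ≤ length π′ → All (m ≢_) π → All (m ≢_) π′ →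
  swapOut t m π ≡ swapOut t′ m π′ → t ≡ t′ × π ≡ π′
swapOut-injective {t = zero}  {zero}  {[]}    {[]}    _        _         _           _           _  = refl , refl
swapOut-injective {t = zero}  {zero}  {_ ∷ _} {_ ∷ _} _        _         _           _           eq
  with refl , refl ← ∷-injective (cong proj₁ eq) | refl ← cong proj₂ eq = refl , refl
swapOut-injective {t = zero}  {suc _} {_ ∷ _} {_ ∷ _} _        _         _           (m≢x′ ∷ _) eq =
  contradiction (∷-injectiveˡ (cong proj₁ eq)) m≢x′
swapOut-injective {t = suc _} {zero}  {_ ∷ _} {_ ∷ _} _        _         (m≢x ∷ _)  _           eq =
  contradiction (sym (∷-injectiveˡ (cong proj₁ eq))) m≢x
swapOut-injective {t = suc _} {suc _} {_ ∷ _} {_ ∷ _} (s≤s t≤) (s≤s t′≤) (_ ∷ π∌)   (_ ∷ π′∌)   eq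
  with refl , tail≡ ← ∷-injective (cong proj₁ eq)
  with refl , refl ← swapOut-injective t≤ t′≤ π∌ π′∌ (cong₂ _,_ tail≡ (cong proj₂ eq)) = refl , refl

app-∷ʳ-last : ∀ ys y → app (ys ∷ʳ y) (suc (length ys)) ≡ y
app-∷ʳ-last []           y = refl
app-∷ʳ-last (x ∷ [])     y = refl
app-∷ʳ-last (x ∷ x′ ∷ ys) y = app-∷ʳ-last (x′ ∷ ys) y

app-++ˡ : ∀ xs ys {i} → InRange (length xs) i → app (xs ++ ys) i ≡ app xs i
app-++ˡ (x ∷ xs)      ys {suc zero}    _              = refl
app-++ˡ (x ∷ x′ ∷ xs) ys {suc (suc i)} (_ , s≤s i<)  = app-++ˡ (x′ ∷ xs) ys (s≤s z≤n , i<)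

app-swapOut-at : ∀ {t} m {π} → t < length π → app (proj₁ (swapOut t m π)) (suc t) ≡ m
app-swapOut-at {zero}  m {_ ∷ _}     _          = refl
app-swapOut-at {suc t} m {_ ∷ _ ∷ _} (s≤s t<)   = app-swapOut-at m t<

app-swapOut-other : ∀ {t} m π y → y ≢ t → app (proj₁ (swapOut t m π)) (suc y) ≡ app π (suc y)
app-swapOut-other         m []       y       _   = refl
app-swapOut-other {zero}  m (x ∷ xs) zero    y≢t = contradiction refl y≢t
app-swapOut-other {zero}  m (x ∷ xs) (suc y) _   = refl
app-swapOut-other {suc t} m (x ∷ xs) zero    _   = refl
app-swapOut-other {suc t} m (x ∷ []) (suc y) _   = refl
app-swapOut-other {suc t} m (x ∷ x′ ∷ xs) (suc y) y≢t = app-swapOut-other m (x′ ∷ xs) y (y≢t ∘ cong suc)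

proj₂-swapOut : ∀ {t} m {π} → t < length π → proj₂ (swapOut t m π) ≡ app π (suc t)
proj₂-swapOut {zero}  m {_ ∷ _}     _        = refl
proj₂-swapOut {suc t} m {_ ∷ _ ∷ _} (s≤s t<) = proj₂-swapOut m t<

module _ {n t π} (t≤n : t ≤ n) (π-perm : IsPerm n π) where
  private
    ρ = cycleInsert t (suc n) π
    ys = proj₁ (swapOut t (suc n) π)
    |ys| : length ys ≡ n
    |ys| = trans (length-swapOut t (suc n) π) (IsPerm.length≡ π-perm)
    ρ-perm : IsPerm (suc n) ρ
    ρ-perm = IsPerm-cons π-perm (cycleInsert-↭ t (suc n) π)
    new∈ : InRange (suc n) (suc n)
    new∈ = s≤s z≤n , ≤-refl

  app-cycleInsert-new : app ρ (suc n) ≡ proj₂ (swapOut t (suc n) π)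
  app-cycleInsert-new = subst (λ l → app ρ (suc l) ≡ proj₂ (swapOut t (suc n) π)) |ys| (app-∷ʳ-last ys _)

  cycleInsert-detour : Detour n π ρ
  cycleInsert-detour {suc y} y∈ with y ≟ t
  ... | no y≢t   = inj₁ (trans (app-++ˡ ys _ y∈ys) (app-swapOut-other (suc n) π y y≢t))
    where y∈ys = subst (λ l → InRange l (suc y)) (sym |ys|) y∈
  ... | yes refl = inj₂
    ( trans (app-++ˡ ys _ y∈ys) (app-swapOut-at (suc n) {π} t<∣π∣)
    , trans app-cycleInsert-new (proj₂-swapOut (suc n) {π} t<∣π∣) )
    where
    y∈ys = subst (λ l → InRange l (suc y)) (sym |ys|) y∈
    t<∣π∣ = IsPerm-position≤ (proj₂ y∈) π-perm

  isCycleMin-cycleInsert-new : isCycleMin (suc n) ρ (suc n) ≡ (t ≡ᵇ n)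
  isCycleMin-cycleInsert-new with m≤n⇒m<n∨m≡n t≤n
  ... | inj₂ refl rewrite dec-true (t ≟ t) refl =
    Equivalence.to T-≡ (Equivalence.from (isCycleMin⇔ ρ-perm new∈) (λ k → ≤-reflexive (sym (fixed k))))
    where
    fixed : ∀ k → iter ρ k (suc t) ≡ suc t
    fixed zero    = refl
    fixed (suc k) = trans (cong (app ρ) (fixed k))
      (trans app-cycleInsert-new (cong proj₂ (subst (λ l → swapOut l (suc t) π ≡ (π , suc t))
                                                    (IsPerm.length≡ π-perm) (swapOut-length (suc t) π))))
  ... | inj₁ t<n rewrite dec-false (t ≟ n) (<⇒≢ t<n) = dec-false (T? _) λ isMin →
    <⇒≱ (s≤s (proj₂ (app-inRange π-perm (s≤s z≤n , t<n))))
        (subst (suc n ≤_) (trans app-cycleInsert-new (proj₂-swapOut (suc n) {π} (IsPerm-position≤ t<n π-perm)))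
               (Equivalence.to (isCycleMin⇔ ρ-perm new∈) isMin 1))

cycleInsertion : ∀ n → Extension n
cycleInsertion n = record
  { extend      = λ t π → cycleInsert t (suc n) π
  ; extend-perm = λ {t} {π} _ π-perm → IsPerm-cons π-perm (cycleInsert-↭ t (suc n) π)
  ; injective   = λ t≤ t′≤ π-perm π′-perm eq → let ys≡ , y≡ = ∷ʳ-injective _ _ eq in
      swapOut-injective (IsPerm-position≤ t≤ π-perm) (IsPerm-position≤ t′≤ π′-perm)
                        (IsPerm-max∉ π-perm) (IsPerm-max∉ π′-perm) (cong₂ _,_ ys≡ y≡)
  ; surjective  = surjective
  }
  where
  preimage : ∀ {ρ} → IsPerm (suc n) ρ → ∃ λ t → ∃ λ π → t ≤ length π × cycleInsert t (suc n) π ≡ ρ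
  preimage {ρ} ρ-perm with initLast ρ
  ... | []       = contradiction (IsPerm.length≡ ρ-perm) λ ()
  ... | ini ∷ʳ′ v with v ≟ suc n
  ...   | yes refl = length ini , ini , ≤-refl , cong (uncurry _∷ʳ_) (swapOut-length (suc n) ini)
  ...   | no  v≢ with ∈-++⁻ ini (max∈IsPerm ρ-perm)
  ...     | inj₂ (here 1+n≡v) = contradiction (sym 1+n≡v) v≢
  ...     | inj₁ 1+n∈ini with ys , zs , refl ← ∈-∃++ 1+n∈ini =
    length ys , ys ++ v ∷ zs , subst (length ys ≤_) (sym (length-++ ys)) (m≤m+n (length ys) _) ,
    cong (uncurry _∷ʳ_) (swapOut-++ (suc n) ys v zs)
  surjective : ∀ {ρ} → IsPerm (suc n) ρ → ∃ λ t → ∃ λ π → t ≤ n × IsPerm n π × cycleInsert t (suc n) π ≡ ρ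
  surjective ρ-perm with t , π , t≤ , refl ← preimage ρ-perm =
    t , π , subst (t ≤_) (IsPerm.length≡ π-perm) t≤ , π-perm , refl
    where
    π-perm = IsPerm-uncons ρ-perm (cycleInsert-↭ t (suc n) π)

range1-suc : ∀ n → range1 (suc n) ≡ range1 n ∷ʳ suc n
range1-suc n = trans (cong (map suc) (sym (upTo-∷ʳ n))) (map-++ suc (upTo n) (n ∷ []))

cycleCount-stirling : StirlingStatistic cycleCount
cycleCount-stirling = record
  { st-[]     = refl
  ; extension = cycleInsertion
  ; st-extend = λ n {t} {π} t≤ π-perm →
      let ρ = cycleInsert t (suc n) π
          ρ-perm = IsPerm-cons π-perm (cycleInsert-↭ t (suc n) π) in begin
      cycleCount (suc n) ρ
        ≡⟨ length-filterᵇ (isCycleMin (suc n) ρ) (range1 (suc n)) ⟩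
      ∑ (range1 (suc n)) (𝟙 ∘ isCycleMin (suc n) ρ)
        ≡⟨ cong (λ is → ∑ is (𝟙 ∘ isCycleMin (suc n) ρ)) (range1-suc n) ⟩
      ∑ (range1 n ∷ʳ suc n) (𝟙 ∘ isCycleMin (suc n) ρ)
        ≡⟨ ∑-++ (range1 n) (suc n ∷ []) _ ⟩
      ∑ (range1 n) (𝟙 ∘ isCycleMin (suc n) ρ) + (𝟙 (isCycleMin (suc n) ρ (suc n)) + 0)
        ≡⟨ cong₂ _+_ (∑-∈-cong (range1 n)
                       (cong 𝟙 ∘ isCycleMin-detour π-perm ρ-perm (cycleInsert-detour t≤ π-perm) ∘ ∈-range1⁻))
                     (trans (+-identityʳ _) (cong 𝟙 (isCycleMin-cycleInsert-new t≤ π-perm))) ⟩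
      ∑ (range1 n) (𝟙 ∘ isCycleMin n π) + 𝟙 (t ≡ᵇ n)
        ≡⟨ +-comm _ (𝟙 (t ≡ᵇ n)) ⟩
      𝟙 (t ≡ᵇ n) + ∑ (range1 n) (𝟙 ∘ isCycleMin n π)
        ≡⟨ cong (𝟙 (t ≡ᵇ n) +_) (length-filterᵇ (isCycleMin n π) (range1 n)) ⟨
      𝟙 (t ≡ᵇ n) + cycleCount n π ∎
  }
  where open ≡-Reasoning

signChoices : ℕ → ℕ → ℕ → ℕ
signChoices n j k = (k C j) * 2 ^ (n ∸ k)

∑-signWords-oddCycles : ∀ {n π} → length π ≡ n → ∀ j →
  ∑ (signWords n) (λ w → 𝟙 (oddCycles (π , w) ≡ᵇ j)) ≡ signChoices n j (compartmentCount n π)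
∑-signWords-oddCycles {π = π} refl j = begin
  ∑ (signWords (length π)) (λ w → 𝟙 (oddCycles (π , w) ≡ᵇ j))
    ≡⟨ ∑-signWords-cong (length π) (λ |w| → cong (λ k → 𝟙 (k ≡ᵇ j)) (oddCycles≡oddBlocks π _ (sym |w|))) ⟩
  ∑ (signWords (length π)) (λ w → 𝟙 (oddBlocks S w ≡ᵇ j))
    ≡⟨ cong (λ l → ∑ (signWords l) (λ w → 𝟙 (oddBlocks S w ≡ᵇ j))) (sym sum-S) ⟩
  oddBlockCount S j
    ≡⟨ oddBlockCount-binomial (compartmentSizes-positive (length π) π) j ⟩
  (length S C j) * 2 ^ (sum S ∸ length S)
    ≡⟨ cong (λ l → (length S C j) * 2 ^ (l ∸ length S)) sum-S ⟩
  signChoices (length π) j (length S) ∎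
  where
  open ≡-Reasoning
  S = compartmentSizes (length π) π
  sum-S : sum S ≡ length π
  sum-S = sum-compartmentSizes (length π) π ≤-refl

a≡∑-compartmentCount : ∀ n j → a n j ≡ ∑ (perms n) (signChoices n j ∘ compartmentCount n)
a≡∑-compartmentCount n j = begin
  a n j
    ≡⟨ length-filterᵇ _ (signedPerms n) ⟩
  ∑ (signedPerms n) (λ σ → 𝟙 (oddCycles σ ≡ᵇ j))
    ≡⟨ ∑-concatMap (λ π → map (π ,_) (signWords n)) (perms n) _ ⟩
  ∑ (perms n) (λ π → ∑ (map (π ,_) (signWords n)) (λ σ → 𝟙 (oddCycles σ ≡ᵇ j)))
    ≡⟨ ∑-∈-cong (perms n) (λ {π} π∈ → trans (∑-map (π ,_) (signWords n) _)
                                           (∑-signWords-oddCycles (IsPerm.length≡ (∈-perms⁻ {n} π∈)) j)) ⟩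
  ∑ (perms n) (signChoices n j ∘ compartmentCount n) ∎
  where open ≡-Reasoning

∑-point : ∀ {xs k} (g : ℕ → ℕ) → Unique xs → k ∈ xs → ∑ xs (λ x → 𝟙 (k ≡ᵇ x) * g x) ≡ g k
∑-point {x ∷ xs} g (x∉ ∷ _) (here refl) = trans
  (cong₂ _+_ (cong (λ b → 𝟙 b * g x) (dec-true (x ≟ x) refl))
             (∑-zero xs {λ y → 𝟙 (x ≡ᵇ y) * g y}
                     (λ {y} y∈ → cong (λ b → 𝟙 b * g y) (dec-false (x ≟ y) (All.lookup x∉ y∈)))))
  (trans (+-identityʳ _) (+-identityʳ (g x)))
∑-point {x ∷ xs} {k} g (x∉ ∷ uxs) (there k∈) = trans
  (cong (_+ ∑ xs (λ y → 𝟙 (k ≡ᵇ y) * g y)) (cong (λ b → 𝟙 b * g x) (dec-false (k ≟ x) (≢-sym (All.lookup x∉ k∈)))))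
  (∑-point g uxs k∈)

∑-point-∉ : ∀ {xs k} (g : ℕ → ℕ) → ¬ k ∈ xs → ∑ xs (λ x → 𝟙 (k ≡ᵇ x) * g x) ≡ 0
∑-point-∉ {xs} {k} g k∉ =
  ∑-zero xs {λ x → 𝟙 (k ≡ᵇ x) * g x} λ {x} x∈ → cong (λ b → 𝟙 b * g x) (dec-false (k ≟ x) λ { refl → k∉ x∈ })

cycleCount≤ : ∀ n π → cycleCount n π ≤ n
cycleCount≤ n π = subst (cycleCount n π ≤_) (length-range1 n) (length-filter (T? ∘ isCycleMin n π) (range1 n))

sumFromTo≡∑-cycleCount : ∀ n j →
  sumFromTo j n (λ i → c n i * (i C j) * 2 ^ (n ∸ i)) ≡ ∑ (perms n) (signChoices n j ∘ cycleCount n)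
sumFromTo≡∑-cycleCount n j = begin
  ∑ (upTo (suc n ∸ j)) (λ t → c n (j + t) * ((j + t) C j) * 2 ^ (n ∸ (j + t)))
    ≡⟨ ∑-map (j +_) (upTo (suc n ∸ j)) _ ⟨
  ∑ is (λ i → c n i * (i C j) * 2 ^ (n ∸ i))
    ≡⟨ ∑-cong is (λ i → trans (*-assoc (c n i) _ _) (trans (cong (_* signChoices n j i) (length-filterᵇ _ (perms n)))
                                                             (sym (∑-*ʳ (perms n) _ _)))) ⟩
  ∑ is (λ i → ∑ (perms n) (λ π → 𝟙 (cycleCount n π ≡ᵇ i) * signChoices n j i))
    ≡⟨ ∑-comm is (perms n) _ ⟩
  ∑ (perms n) (λ π → ∑ is (λ i → 𝟙 (cycleCount n π ≡ᵇ i) * signChoices n j i))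
    ≡⟨ ∑-cong (perms n) (λ π → pick (cycleCount n π) (cycleCount≤ n π)) ⟩
  ∑ (perms n) (signChoices n j ∘ cycleCount n) ∎
  where
  open ≡-Reasoning
  is = map (j +_) (upTo (suc n ∸ j))
  pick : ∀ m → m ≤ n → ∑ is (λ i → 𝟙 (m ≡ᵇ i) * signChoices n j i) ≡ signChoices n j m
  pick m m≤n with j ≤? m
  ... | yes j≤m = ∑-point (signChoices n j) (Unique.map⁺ (+-cancelˡ-≡ j _ _) (Unique.upTo⁺ (suc n ∸ j)))
                    (subst (_∈ is) (m+[n∸m]≡n j≤m) (∈-map⁺ (j +_) (∈-upTo⁺ (∸-monoˡ-< (s≤s m≤n) j≤m))))
  ... | no  j≰m = trans (∑-point-∉ {is} (signChoices n j) λ m∈ → let t , _ , m≡ = ∈-map⁻ (j +_) m∈ in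
                                                          j≰m (subst (j ≤_) (sym m≡) (m≤m+n j t)))
                        (sym (cong (_* 2 ^ (n ∸ m)) (k>n⇒nCk≡0 (≰⇒> j≰m))))

proposition2p3 : (n j : ℕ) → 1 ≤ n → j ≤ n →
    a n j ≡ sumFromTo j n (λ i → c n i * (i C j) * 2 ^ (n ∸ i))
proposition2p3 n j _ _ = begin
  a n j                                              ≡⟨ a≡∑-compartmentCount n j ⟩
  ∑ (perms n) (signChoices n j ∘ compartmentCount n) ≡⟨ ∑-perms≡stirlingSum compartmentCount-stirling n _ ⟩
  stirlingSum n (signChoices n j)                    ≡⟨ ∑-perms≡stirlingSum cycleCount-stirling n _ ⟨
  ∑ (perms n) (signChoices n j ∘ cycleCount n)       ≡⟨ sumFromTo≡∑-cycleCount n j ⟨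
  sumFromTo j n (λ i → c n i * (i C j) * 2 ^ (n ∸ i)) ∎
  where open ≡-Reasoning
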